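{- Let $k$ be a perfect field of characteristic $p>0$, $K=k((t))$, and let $L/K$ be a near one-dimensional elementary abelian extension of degree $q=p^{n+1}$ with largest lower ramification number $b_{\max}$ (which satisfies $p\nmid b_{\max}$). For $0\le a\le q-1$ let $d_a=\lfloor(1+a)b_{\max}/q\rfloor$, and for $0\le j\le q-1$ let $w_j=\min\{d_{a+j}-d_a:0\le a\le q-1,\ a\preceq q-1-j\}$. Then $w_j=d_j-d_0$ for all $0\le j\le q-1$ if and only if $$r(-b_{\max})+r(-i\,b_{\max})-r(-h\,b_{\max})>0$$ for all integers $h,i,j$ with $0\le h\le i\le j<q$ satisfying $i+j=q-1+h$ and $\binom{i}{h}\not\equiv0\pmod p$.
   Context: $r(x)$ denotes the least non-negative residue of $x$ modulo $q$. For integers $x\ge0$ write $x=\sum_{s\ge0}x_{(s)}p^s$ with $0\le x_{(s)}<p$; $x\preceq y$ means $x_{(s)}\le y_{(s)}$ for all $0\le s\le n$. $v_K$ is the normalized valuation on $K$, $\mathfrak{O}_K$ its valuation ring and $\mathfrak{P}_K$ its maximal ideal. An elementary abelian extension $L=K(x_0,\dots,x_n)$ of $K$ of degree $q=p^{n+1}$ is near one-dimensional elementary abelian if $x_i^p-x_i=\Omega_i^{p^n}\beta+\epsilon_i$ ($0\le i\le n$) where $\beta\in K$, $v_K(\beta)=-b<0$, $\gcd(b,p)=1$; $\Omega_0=1,\Omega_1,\dots,\Omega_n\in K$ with $v_K(\Omega_n)\le\cdots\le v_K(\Omega_1)\le v_K(\Omega_0)=0$, and whenever $v_K(\Omega_i)=\cdots=v_K(\Omega_j)$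 for $i<j$, the images of $\Omega_i,\dots,\Omega_j$ in $\Omega_i\mathfrak{O}_K/\Omega_i\mathfrak{P}_K$ are linearly independent over $\mathbb{F}_p$; and $\epsilon_i\in K$ with $v_K(\epsilon_i)>v_K(\Omega_i^{p^n}\beta)+\frac{(p^n-1)b}{p^n}-(p-1)\sum_{j=1}^{n-1}p^jv_K(\Omega_j)$. -}

module Defs where

open import Data.Nat using (ℕ; zero; suc; _+_; _*_; _∸_; _^_; _≤ᵇ_; _⊓_; NonZero)
open import Data.Nat.DivMod using (_/_; _%_)
open import Data.Nat.Properties using (m^n≢0)
open import Data.Integer as ℤ using (ℤ; +_; -_; _%ℕ_)
open import Data.List using (List; []; _∷_; foldr; filter; map; upTo)
open import Data.Bool using (Bool; T; true; _∧_)
open import Relation.Nullary.Decidable using (T?)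

q : ℕ → ℕ → ℕ
q p n = p ^ suc n

q-nonZero : (p n : ℕ) → {{NonZero p}} → NonZero (q p n)
q-nonZero p n = m^n≢0 p (suc n)

r : (p n : ℕ) → {{NonZero p}} → ℤ → ℕ
r p n x = (x %ℕ q p n) {{q-nonZero p n}}

digit : (p : ℕ) → {{NonZero p}} → ℕ → ℕ → ℕ
digit p x s = (x / (p ^ s)) {{m^n≢0 p s}} % p

preceqᵇ : (p n : ℕ) → {{NonZero p}} → ℕ → ℕ → Bool
preceqᵇ p n x y = allᵇ (map (λ s → digit p x s ≤ᵇ digit p y s) (upTo (suc n)))
  where
  allᵇ : List Bool → Bool
  allᵇ = foldr _∧_ true

_⪯[_,_]_ : ℕ → (p n : ℕ) → {{NonZero p}} → ℕ → Set
x ⪯[ p , n ] y = T (preceqᵇ p n x y)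

d : (p n : ℕ) → {{NonZero p}} → (b a : ℕ) → ℕ
d p n b a = (((1 + a) * b) / q p n) {{q-nonZero p n}}

-- minimum of a list (0 on the empty list; only used on nonempty lists)
minList : List ℕ → ℕ
minList [] = 0
minList (x ∷ xs) = foldr _⊓_ x xs

w : (p n : ℕ) → {{NonZero p}} → (b j : ℕ) → ℕ
w p n b j =
  minList (map (λ a → d p n b (a + j) ∸ d p n b a)
               (filter (λ a → T? (preceqᵇ p n a (q p n ∸ 1 ∸ j))) (upTo (q p n))))

module Submission where

-- The proof combines three independent ingredients, developed in this order.
--   * Digits: the digit-wise order ≼ on base-p expansions is preserved by
--     digit-wise subtraction and reversed by complementation x ↦ c − x.
--   * Lucas: p ∤ (i C h) iff h ≼ i, from the congruence
--     (A C K) ≡ (A/p C K/p)(A%p C K%p) (mod p), proved by Pascal's rule.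
--   * Residues: writing xb = Q⌊xb/Q⌋ + r(xb), the inequality
--     d_{a+j} − d_a ≥ d_j − d_0 holds iff r((a+j+1)b) < r(−b) + r((a+1)b), and
--     r(−xb) = r((Q−x)b).
-- In the theorem the index triple (h, i, j) of the residue condition and the
-- pair (a, j) of the definition of w correspond via h = c − a − j, i = c − a,
-- and Lucas' theorem together with the digit lemmas matches the side
-- conditions p ∤ (i C h) and a ⪯ c − j.

open import Defs
open import Data.Bool using (Bool)
open import Data.Empty using (⊥-elim)
open import Data.Integer using (+_; -_; _%ℕ_)
open import Data.List using (List; []; _∷_; foldr; map; filter; upTo)
open import Data.List.Membership.Propositional using (_∈_)
open import Data.List.Membership.Propositional.Properties
  using (∈-map⁺; ∈-map⁻; ∈-filter⁺; ∈-filter⁻; ∈-upTo⁺; ∈-upTo⁻)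
open import Data.List.Relation.Unary.Any using (here; there)
open import Data.List.Relation.Unary.All.Properties using (all⁺; all⁻; applyUpTo⁺₁; applyUpTo⁻)
open import Data.Nat
open import Data.Nat.Properties
open import Data.Nat.DivMod
open import Data.Nat.Divisibility
open import Data.Nat.Primality using (Prime; euclidsLemma; prime⇒nonTrivial)
open import Data.Nat.Combinatorics
open import Data.Nat.Tactic.RingSolver using (solve-∀)
open import Data.Product using (_×_; _,_; ∃)
open import Data.Sum using (_⊎_; inj₁; inj₂)
open import Data.Unit using (⊤; tt)
open import Function.Bundles using (_⇔_; mk⇔)
open import Relation.Binary.PropositionalEquality hiding (J)
open import Relation.Nullary using (¬_; yes; no)
open import Relation.Nullary.Decidable using (T?)

∸-distrib-+ : ∀ {s t u v} → s ≤ t → u ≤ v → (t + v) ∸ (s + u) ≡ (t ∸ s) + (v ∸ u)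
∸-distrib-+ {s} {t} {u} {v} s≤t u≤v = begin
  (t + v) ∸ (s + u) ≡⟨ ∸-+-assoc (t + v) s u ⟨
  (t + v ∸ s) ∸ u   ≡⟨ cong (_∸ u) (+-∸-comm v s≤t) ⟩
  (t ∸ s + v) ∸ u   ≡⟨ +-∸-assoc (t ∸ s) u≤v ⟩
  (t ∸ s) + (v ∸ u) ∎
  where open ≡-Reasoning

∸≤∸⇒+≤+ : ∀ {s t u v} → s ≤ t → u ≤ v → t ∸ s ≤ v ∸ u → u + t ≤ v + s
∸≤∸⇒+≤+ {s} {t} {u} {v} s≤t u≤v le = begin
  u + t             ≡⟨ cong (λ z → u + z) (m∸n+n≡m s≤t) ⟨
  u + ((t ∸ s) + s) ≤⟨ +-monoʳ-≤ u (+-monoˡ-≤ s le) ⟩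
  u + ((v ∸ u) + s) ≡⟨ +-assoc u (v ∸ u) s ⟨
  (u + (v ∸ u)) + s ≡⟨ cong (_+ s) (m+[n∸m]≡n u≤v) ⟩
  v + s             ∎
  where open ≤-Reasoning

+≤+⇒∸≤∸ : ∀ {s t u v} → u + t ≤ v + s → t ∸ s ≤ v ∸ u
+≤+⇒∸≤∸ {s} {t} {u} {v} le = begin
  t ∸ s             ≡⟨ [m+n]∸[m+o]≡n∸o u t s ⟨
  (u + t) ∸ (u + s) ≤⟨ ∸-monoˡ-≤ (u + s) le ⟩
  (v + s) ∸ (u + s) ≡⟨ cong₂ _∸_ (+-comm v s) (+-comm u s) ⟩
  (s + v) ∸ (s + u) ≡⟨ [m+n]∸[m+o]≡n∸o s v u ⟩
  v ∸ u             ∎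
  where open ≤-Reasoning

split-≤ : ∀ Q {α β X Y} → Q * α + Y ≡ Q * β + X → β ≤ α → Y ≤ X
split-≤ Q {α} {β} {X} {Y} e β≤α =
  +-cancelˡ-≤ (Q * β) Y X (≤-trans (+-monoˡ-≤ Y (*-monoʳ-≤ Q β≤α)) (≤-reflexive e))

split-≥ : ∀ Q {α β X Y} → Q * α + Y ≡ Q * β + X → Y < Q + X → β ≤ α
split-≥ Q {α} {β} {X} {Y} e Y<Q+X =
  m<1+n⇒m≤n (*-cancelˡ-< Q β (suc α) (+-cancelʳ-< X (Q * β) (Q * suc α) lt))
  where
  open ≤-Reasoning
  regroup : ∀ Q α X → Q * α + (Q + X) ≡ Q * suc α + X
  regroup = solve-∀
  lt : Q * β + X < Q * suc α + X
  lt = begin-strict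
    Q * β + X       ≡⟨ e ⟨
    Q * α + Y       <⟨ +-monoʳ-< (Q * α) Y<Q+X ⟩
    Q * α + (Q + X) ≡⟨ regroup Q α X ⟩
    Q * suc α + X   ∎

-%ℕ≡ : ∀ m Q → {{_ : NonZero Q}} → (- (+ m)) %ℕ Q ≡ (Q ∸ m % Q) % Q
-%ℕ≡ zero    Q@(suc _) = sym (n%n≡0 Q)
-%ℕ≡ (suc m) Q@(suc Q-1) with suc m % Q
... | zero  = sym (n%n≡0 Q)
... | suc k = sym (m<n⇒m%n≡m (s≤s (m∸n≤m Q-1 k)))

%-complement : ∀ {u v Q} → {{_ : NonZero Q}} → (u + v) % Q ≡ 0 → u % Q ≡ (Q ∸ v % Q) % Q
%-complement {u} {v} {Q} u+v≡0 = begin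
  u % Q                             ≡⟨ [m+n]%n≡m%n u Q ⟨
  (u + Q) % Q                       ≡⟨ cong (λ z → (u + z) % Q) (m∸n+n≡m (<⇒≤ (m%n<n v Q))) ⟨
  (u + (t + v % Q)) % Q             ≡⟨ cong (_% Q) (rotate u t (v % Q)) ⟩
  ((u + v % Q) + t) % Q             ≡⟨ %-distribˡ-+ (u + v % Q) t Q ⟩
  ((u + v % Q) % Q + t % Q) % Q     ≡⟨ cong (λ z → (z + t % Q) % Q) u+v%Q≡0 ⟩
  t % Q % Q                         ≡⟨ m%n%n≡m%n t Q ⟩
  t % Q                             ∎
  where
  open ≡-Reasoning
  t = Q ∸ v % Q
  rotate : ∀ x y z → x + (y + z) ≡ (x + z) + y
  rotate = solve-∀
  u+v%Q≡0 : (u + v % Q) % Q ≡ 0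
  u+v%Q≡0 = begin
    (u + v % Q) % Q           ≡⟨ %-distribˡ-+ u (v % Q) Q ⟩
    (u % Q + v % Q % Q) % Q   ≡⟨ cong (λ z → (u % Q + z) % Q) (m%n%n≡m%n v Q) ⟩
    (u % Q + v % Q) % Q       ≡⟨ %-distribˡ-+ u v Q ⟨
    (u + v) % Q               ≡⟨ u+v≡0 ⟩
    0                         ∎

C*!*!≡! : ∀ {n k} → k ≤ n → (n C k) * (k ! * (n ∸ k) !) ≡ n !
C*!*!≡! {n} {k} k≤n =
  trans (cong (_* (k ! * (n ∸ k) !)) (nCk≡n!/k![n-k]! k≤n))
        (m/n*n≡m {{k !* (n ∸ k) !≢0}} (k![n∸k]!∣n! k≤n))

n∣n! : ∀ n → {{_ : NonZero n}} → n ∣ n !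
n∣n! (suc n) = m∣m*n (n !)

⊓-fold-≤ : ∀ x xs {y} → y ∈ x ∷ xs → foldr _⊓_ x xs ≤ y
⊓-fold-≤ x []       (here refl)         = ≤-refl
⊓-fold-≤ x (z ∷ zs) (here refl)         = ≤-trans (m⊓n≤n z _) (⊓-fold-≤ x zs (here refl))
⊓-fold-≤ x (z ∷ zs) (there (here refl)) = m⊓n≤m z _
⊓-fold-≤ x (z ∷ zs) (there (there y∈))  = ≤-trans (m⊓n≤n z _) (⊓-fold-≤ x zs (there y∈))

⊓-fold-glb : ∀ x xs {m} → (∀ {y} → y ∈ x ∷ xs → m ≤ y) → m ≤ foldr _⊓_ x xs
⊓-fold-glb x []       bound = bound (here refl)
⊓-fold-glb x (z ∷ zs) {m} bound = ⊓-glb (bound (there (here refl))) (⊓-fold-glb x zs bound′)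
  where
  bound′ : ∀ {y} → y ∈ x ∷ zs → m ≤ y
  bound′ (here e)   = bound (here e)
  bound′ (there y∈) = bound (there (there y∈))

minList-≤ : ∀ {y ys} → y ∈ ys → minList ys ≤ y
minList-≤ {ys = x ∷ xs} y∈ = ⊓-fold-≤ x xs y∈

minList-unique : ∀ {y ys} → y ∈ ys → (∀ {z} → z ∈ ys → y ≤ z) → minList ys ≡ y
minList-unique {ys = x ∷ xs} y∈ least = ≤-antisym (⊓-fold-≤ x xs y∈) (⊓-fold-glb x xs least)

-- Base-p digits and the digit-wise order.
module Digits (p : ℕ) {{p≢0 : NonZero p}} where

  euclid-unique : ∀ {r} k → r < p → (r + k * p) % p ≡ r × (r + k * p) / p ≡ k
  euclid-unique {r} k r<p =
      trans ([m+kn]%n≡m%n r k p) (m<n⇒m%n≡m r<p)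
    , trans (+-distrib-/ r (k * p) small) (cong₂ _+_ (m<n⇒m/n≡0 r<p) (m*n/n≡m k p))
    where
    small : r % p + k * p % p < p
    small = subst₂ (λ u v → u + v < p) (sym (m<n⇒m%n≡m r<p)) (sym (m*n%n≡0 k p))
                   (subst (_< p) (sym (+-identityʳ r)) r<p)

  0%p≡0 : 0 % p ≡ 0
  0%p≡0 = m<n⇒m%n≡m (>-nonZero⁻¹ p)

  0/p≡0 : 0 / p ≡ 0
  0/p≡0 = 0/n≡0 p

  split-digit : ∀ x → x ≡ x % p + x / p * p
  split-digit x = m≡m%n+[m/n]*n x p

  high-< : ∀ m {x} → x < p ^ suc m → x / p < p ^ m
  high-< m {x} lt = m<n*o⇒m/o<n (subst (x <_) (*-comm p (p ^ m)) lt)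

  all-top : ∀ m → p ^ suc m ∸ 1 ≡ (p ∸ 1) + (p ^ m ∸ 1) * p
  all-top m = product-pred p (p ^ m) {{p≢0}} {{m^n≢0 p m}}
    where
    expand : ∀ a b → suc a * suc b ≡ suc (a + b * suc a)
    expand = solve-∀
    product-pred : ∀ a b → {{NonZero a}} → {{NonZero b}} → a * b ∸ 1 ≡ (a ∸ 1) + (b ∸ 1) * a
    product-pred (suc a) (suc b) = cong pred (expand a b)

  data SucDigits (A : ℕ) : Set where
    no-carry : suc (A % p) < p → suc A % p ≡ suc (A % p) → suc A / p ≡ A / p → SucDigits A
    carry    : suc (A % p) ≡ p → suc A % p ≡ 0 → suc A / p ≡ suc (A / p) → SucDigits A

  sucDigits : ∀ A → SucDigits A
  sucDigits A with m≤n⇒m<n∨m≡n (m%n<n A p)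
  ... | inj₁ lt =
    let (low , high) = euclid-unique (A / p) lt
    in no-carry lt (trans (cong (_% p) (cong suc (split-digit A))) low)
                   (trans (cong (_/ p) (cong suc (split-digit A))) high)
  ... | inj₂ eq =
    let (low , high) = euclid-unique (suc (A / p)) (>-nonZero⁻¹ p)
        A+1≡ : suc A ≡ 0 + suc (A / p) * p
        A+1≡ = trans (cong suc (split-digit A)) (cong (_+ A / p * p) eq)
    in carry eq (trans (cong (_% p) A+1≡) low) (trans (cong (_/ p) A+1≡) high)

  infix 4 _≼[_]_
  _≼[_]_ : ℕ → ℕ → ℕ → Set
  x ≼[ zero ] y  = ⊤
  x ≼[ suc m ] y = x % p ≤ y % p × x / p ≼[ m ] y / p

  digit-zero : ∀ x → digit p x 0 ≡ x % p
  digit-zero x = cong (_% p) (n/1≡n x)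

  digit-suc : ∀ x s → digit p x (suc s) ≡ digit p (x / p) s
  digit-suc x s =
    cong (_% p) (sym (m/n/o≡m/[n*o] x p (p ^ s) {{p≢0}} {{m^n≢0 p s}} {{m^n≢0 p (suc s)}}))

  ≼⇒digits-≤ : ∀ m {x y} → x ≼[ m ] y → ∀ {s} → s < m → digit p x s ≤ digit p y s
  ≼⇒digits-≤ (suc m) {x} {y} (low , _) {zero} _ =
    subst₂ _≤_ (sym (digit-zero x)) (sym (digit-zero y)) low
  ≼⇒digits-≤ (suc m) {x} {y} (_ , high) {suc s} (s≤s s<m) =
    subst₂ _≤_ (sym (digit-suc x s)) (sym (digit-suc y s)) (≼⇒digits-≤ m high s<m)

  digits-≤⇒≼ : ∀ m {x y} → (∀ {s} → s < m → digit p x s ≤ digit p y s) → x ≼[ m ] y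
  digits-≤⇒≼ zero _ = tt
  digits-≤⇒≼ (suc m) {x} {y} le =
      subst₂ _≤_ (digit-zero x) (digit-zero y) (le z<s)
    , digits-≤⇒≼ m (λ {s} s<m → subst₂ _≤_ (digit-suc x s) (digit-suc y s) (le (s<s s<m)))

  digit-≤ᵇ : ℕ → ℕ → ℕ → Bool
  digit-≤ᵇ x y s = digit p x s ≤ᵇ digit p y s

  ⪯⇒≼ : ∀ n {x y} → x ⪯[ p , n ] y → x ≼[ suc n ] y
  ⪯⇒≼ n {x} {y} t =
    digits-≤⇒≼ (suc n) λ s<n →
      ≤ᵇ⇒≤ _ _ (applyUpTo⁻ (λ s → s) (suc n) (all⁺ (digit-≤ᵇ x y) (upTo (suc n)) t) s<n)

  ≼⇒⪯ : ∀ n {x y} → x ≼[ suc n ] y → x ⪯[ p , n ] y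
  ≼⇒⪯ n {x} {y} le =
    all⁻ (digit-≤ᵇ x y) (applyUpTo⁺₁ (λ s → s) (suc n) λ s<n → ≤⇒≤ᵇ (≼⇒digits-≤ (suc n) le s<n))

  0≼ : ∀ m y → 0 ≼[ m ] y
  0≼ zero    y = tt
  0≼ (suc m) y =
      subst (_≤ y % p) (sym 0%p≡0) z≤n
    , subst (_≼[ m ] y / p) (sym 0/p≡0) (0≼ m (y / p))

  ≼⇒≤ : ∀ m {x y} → x < p ^ m → x ≼[ m ] y → x ≤ y
  ≼⇒≤ zero    (s≤s z≤n) _ = z≤n
  ≼⇒≤ (suc m) {x} {y} lt (low , high) = subst₂ _≤_ (sym (split-digit x)) (sym (split-digit y))
    (+-mono-≤ low (*-monoˡ-≤ p (≼⇒≤ m (high-< m lt) high)))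

  ≼-digits : ∀ {m r k r′ k′} → r < p → r′ < p → r ≤ r′ → k ≼[ m ] k′
             → r + k * p ≼[ suc m ] r′ + k′ * p
  ≼-digits {k = k} {k′ = k′} r<p r′<p r≤r′ k≼k′ =
    let (low , high) = euclid-unique k r<p ; (low′ , high′) = euclid-unique k′ r′<p
    in subst₂ _≤_ (sym low) (sym low′) r≤r′ , subst₂ (_≼[ _ ]_) (sym high) (sym high′) k≼k′

  -- If x ≼ y then y − x is computed digit by digit, without borrows.
  ≼-∸ : ∀ m {x y} → x < p ^ m → x ≼[ m ] y → y ∸ x ≼[ m ] y
  ≼-∸ zero    _ _ = tt
  ≼-∸ (suc m) {x} {y} lt (low , high) =
    subst₂ (_≼[ suc m ]_) (sym y∸x≡) (sym (split-digit y))
      (≼-digits (≤-<-trans (m∸n≤m (y % p) (x % p)) (m%n<n y p)) (m%n<n y p) (m∸n≤m (y % p) (x % p))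
                (≼-∸ m (high-< m lt) high))
    where
    open ≡-Reasoning
    y∸x≡ : y ∸ x ≡ (y % p ∸ x % p) + (y / p ∸ x / p) * p
    y∸x≡ = begin
      y ∸ x
        ≡⟨ cong₂ _∸_ (split-digit y) (split-digit x) ⟩
      (y % p + y / p * p) ∸ (x % p + x / p * p)
        ≡⟨ ∸-distrib-+ low (*-monoˡ-≤ p (≼⇒≤ m (high-< m lt) high)) ⟩
      (y % p ∸ x % p) + (y / p * p ∸ x / p * p)
        ≡⟨ cong (λ z → (y % p ∸ x % p) + z) (*-distribʳ-∸ p (y / p) (x / p)) ⟨
      (y % p ∸ x % p) + (y / p ∸ x / p) * p
        ∎

  ≼-top∸ : ∀ m {x y} → x < p ^ m → y < p ^ m → x ≼[ m ] y
           → p ^ m ∸ 1 ∸ y ≼[ m ] p ^ m ∸ 1 ∸ x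
  ≼-top∸ zero    _ _ _ = tt
  ≼-top∸ (suc m) {x} {y} x< y< (low , high) =
    subst₂ (_≼[ suc m ]_) (sym (top∸ y y<)) (sym (top∸ x x<))
      (≼-digits (top-digit< y) (top-digit< x) (∸-monoʳ-≤ (p ∸ 1) low)
                (≼-top∸ m (high-< m x<) (high-< m y<) high))
    where
    top-digit< : ∀ z → (p ∸ 1) ∸ z % p < p
    top-digit< z = m≤pred[n]⇒suc[m]≤n (m∸n≤m (p ∸ 1) (z % p))
    top∸ : ∀ z → z < p ^ suc m → p ^ suc m ∸ 1 ∸ z ≡ ((p ∸ 1) ∸ z % p) + ((p ^ m ∸ 1) ∸ z / p) * p
    top∸ z z< = begin
      p ^ suc m ∸ 1 ∸ z
        ≡⟨ cong₂ _∸_ (all-top m) (split-digit z) ⟩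
      ((p ∸ 1) + (p ^ m ∸ 1) * p) ∸ (z % p + z / p * p)
        ≡⟨ ∸-distrib-+ (<⇒≤pred (m%n<n z p)) (*-monoˡ-≤ p (<⇒≤pred (high-< m z<))) ⟩
      ((p ∸ 1) ∸ z % p) + ((p ^ m ∸ 1) * p ∸ z / p * p)
        ≡⟨ cong (λ t → ((p ∸ 1) ∸ z % p) + t) (*-distribʳ-∸ p (p ^ m ∸ 1) (z / p)) ⟨
      ((p ∸ 1) ∸ z % p) + ((p ^ m ∸ 1) ∸ z / p) * p
        ∎
      where open ≡-Reasoning

  ≼-sub : ∀ m {x y z} → x < p ^ m → x + z ≡ y → x ≼[ m ] y → z ≼[ m ] y
  ≼-sub m {x} {y} {z} x< x+z≡y x≼y =
    subst (_≼[ m ] y) (trans (cong (_∸ x) (sym x+z≡y)) (m+n∸m≡n x z)) (≼-∸ m x< x≼y)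

  ≼-complement : ∀ m {x x′ y y′} → x + x′ ≡ p ^ m ∸ 1 → y + y′ ≡ p ^ m ∸ 1
                 → x ≼[ m ] y → y′ ≼[ m ] x′
  ≼-complement m ex ey x≼y =
    subst₂ (_≼[ m ]_) (complement ey) (complement ex) (≼-top∸ m (below ex) (below ey) x≼y)
    where
    complement : ∀ {u u′} → u + u′ ≡ p ^ m ∸ 1 → p ^ m ∸ 1 ∸ u ≡ u′
    complement {u} {u′} e = trans (cong (_∸ u) (sym e)) (m+n∸m≡n u u′)
    below : ∀ {u u′} → u + u′ ≡ p ^ m ∸ 1 → u < p ^ m
    below {u} {u′} e = m≤pred[n]⇒suc[m]≤n {{m^n≢0 p m}} (subst (u ≤_) e (m≤m+n u u′))

-- Lucas' theorem: modulo a prime p, binomial coefficients factor over base-p digits.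
module Lucas (p : ℕ) {{p≢0 : NonZero p}} (p-prime : Prime p) where
  open Digits p {{p≢0}}

  1<p : 1 < p
  1<p = nonTrivial⇒n>1 p {{prime⇒nonTrivial p-prime}}

  p∤! : ∀ {k} → k < p → ¬ p ∣ k !
  p∤! {zero}  _   p∣1 = <⇒≢ 1<p (sym (∣1⇒≡1 p∣1))
  p∤! {suc k} k<p p∣ with euclidsLemma (suc k) (k !) p-prime p∣
  ... | inj₁ p∣k+1 = <⇒≱ k<p (∣⇒≤ p∣k+1)
  ... | inj₂ p∣k!  = p∤! (<-trans (n<1+n k) k<p) p∣k!

  p∤C : ∀ {a k} → k ≤ a → a < p → ¬ p ∣ a C k
  p∤C k≤a a<p p∣C = p∤! a<p (subst (p ∣_) (C*!*!≡! k≤a) (∣m⇒∣m*n _ p∣C))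

  p∣C : ∀ {k} → 0 < k → k < p → p ∣ p C k
  p∣C {k} 0<k k<p with euclidsLemma (p C k) (k ! * (p ∸ k) !) p-prime p∣C*!*!
    where
    p∣C*!*! : p ∣ (p C k) * (k ! * (p ∸ k) !)
    p∣C*!*! = subst (p ∣_) (sym (C*!*!≡! (<⇒≤ k<p))) (n∣n! p)
  ... | inj₁ p∣C   = p∣C
  ... | inj₂ p∣!*! with euclidsLemma (k !) ((p ∸ k) !) p-prime p∣!*!
  ...   | inj₁ p∣k!   = ⊥-elim (p∤! k<p p∣k!)
  ...   | inj₂ p∣p-k! = ⊥-elim (p∤! (∸-monoʳ-< 0<k (<⇒≤ k<p)) p∣p-k!)

  lucasFactor : ℕ → ℕ → ℕ
  lucasFactor A K = ((A / p) C (K / p)) * ((A % p) C (K % p))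

  0C[1+k]≡0 : ∀ k → 0 C suc k ≡ 0
  0C[1+k]≡0 k = k>n⇒nCk≡0 (z<s {k})

  pascal : ∀ n k → (n C k) + (n C suc k) ≡ suc n C suc k
  pascal = nCk+nC[k+1]≡[n+1]C[k+1]

  lucasFactor-pascal : ∀ A K
    → (lucasFactor A K + lucasFactor A (suc K)) % p ≡ lucasFactor (suc A) (suc K) % p
  lucasFactor-pascal A K with sucDigits A | sucDigits K
  -- no carries: Pascal's rule for the lowest digits
  ... | no-carry _ a1 a2 | no-carry _ k1 k2 rewrite a1 | a2 | k1 | k2 =
    cong (_% p) (trans (sym (*-distribˡ-+ X _ _)) (cong (X *_) (pascal (A % p) (K % p))))
    where X = (A / p) C (K / p)
  -- only K + 1 carries: then A % p < K % p = p − 1 kills the first term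
  ... | no-carry a<p a1 a2 | carry k+1≡p k1 k2 rewrite a1 | a2 | k1 | k2 =
    cong (λ z → (z + (A / p C suc (K / p)) * 1) % p) X*0≡0
    where
    X = (A / p) C (K / p)
    X*0≡0 : X * ((A % p) C (K % p)) ≡ 0
    X*0≡0 = trans (cong (X *_) (k>n⇒nCk≡0 (<-pred (subst (suc (A % p) <_) (sym k+1≡p) a<p))))
                  (*-zeroʳ X)
  -- only A + 1 carries: the lowest digits combine to p C (K % p + 1) ≡ 0
  ... | carry a+1≡p a1 a2 | no-carry k<p k1 k2 rewrite a1 | a2 | k1 | k2 = begin
    (X * (A % p C K % p) + X * (A % p C suc (K % p))) % p
      ≡⟨ cong (_% p) (*-distribˡ-+ X _ _) ⟨
    (X * (A % p C K % p + A % p C suc (K % p))) % p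
      ≡⟨ cong (λ z → (X * z) % p) (pascal (A % p) (K % p)) ⟩
    (X * (suc (A % p) C suc (K % p))) % p
      ≡⟨ cong (λ z → (X * (z C suc (K % p))) % p) a+1≡p ⟩
    (X * (p C suc (K % p))) % p
      ≡⟨ n∣m⇒m%n≡0 _ p (∣n⇒∣m*n X (p∣C z<s k<p)) ⟩
    0
      ≡⟨ trans (cong (_% p) (*-zeroʳ (suc (A / p) C (K / p)))) 0%p≡0 ⟨
    (suc (A / p) C (K / p)) * 0 % p
      ∎
    where
    open ≡-Reasoning
    X = (A / p) C (K / p)
  -- both carry: A % p = K % p = p − 1, and Pascal's rule for the higher parts
  ... | carry a+1≡p a1 a2 | carry k+1≡p k1 k2 rewrite a1 | a2 | k1 | k2 =
    cong (_% p) (begin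
      X * (A % p C K % p) + Y * 1 ≡⟨ cong (λ z → X * (A % p C z) + Y * 1) a≡k ⟨
      X * (A % p C A % p) + Y * 1 ≡⟨ cong₂ _+_ (trans (cong (X *_) (nCn≡1 (A % p))) (*-identityʳ X))
                                                (*-identityʳ Y) ⟩
      X + Y                       ≡⟨ pascal (A / p) (K / p) ⟩
      suc (A / p) C suc (K / p)   ≡⟨ *-identityʳ _ ⟨
      (suc (A / p) C suc (K / p)) * 1 ∎)
    where
    open ≡-Reasoning
    X = (A / p) C (K / p)
    Y = (A / p) C suc (K / p)
    a≡k : A % p ≡ K % p
    a≡k = suc-injective (trans a+1≡p (sym k+1≡p))

  lucas : ∀ A K → (A C K) % p ≡ lucasFactor A K % p
  lucas A       zero    rewrite 0/p≡0 | 0%p≡0 = refl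
  lucas zero    (suc K) = begin
    (0 C suc K) % p            ≡⟨ cong (_% p) (0C[1+k]≡0 K) ⟩
    0 % p                      ≡⟨ cong (_% p) vanishes ⟨
    lucasFactor 0 (suc K) % p  ∎
    where
    open ≡-Reasoning
    -- a positive index occurs as a digit or in the higher part of K + 1
    vanishes : lucasFactor 0 (suc K) ≡ 0
    vanishes with sucDigits K
    ... | no-carry _ k1 _ rewrite 0%p≡0 | k1 =
      trans (cong (((0 / p) C (suc K / p)) *_) (0C[1+k]≡0 (K % p))) (*-zeroʳ ((0 / p) C (suc K / p)))
    ... | carry _ _ k2    rewrite 0/p≡0 | k2 = cong (_* ((0 % p) C (suc K % p))) (0C[1+k]≡0 (K / p))
  lucas (suc A) (suc K) = begin
    (suc A C suc K) % p
      ≡⟨ cong (_% p) (pascal A K) ⟨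
    ((A C K) + (A C suc K)) % p
      ≡⟨ %-distribˡ-+ (A C K) (A C suc K) p ⟩
    ((A C K) % p + (A C suc K) % p) % p
      ≡⟨ cong₂ (λ u v → (u + v) % p) (lucas A K) (lucas A (suc K)) ⟩
    (lucasFactor A K % p + lucasFactor A (suc K) % p) % p
      ≡⟨ %-distribˡ-+ (lucasFactor A K) (lucasFactor A (suc K)) p ⟨
    (lucasFactor A K + lucasFactor A (suc K)) % p
      ≡⟨ lucasFactor-pascal A K ⟩
    lucasFactor (suc A) (suc K) % p
      ∎
    where open ≡-Reasoning

  lucas-≼ : ∀ m {h i} → h < p ^ m → i < p ^ m → (i C h) % p ≢ 0 → h ≼[ m ] i
  lucas-≼ zero    _ _ _ = tt
  lucas-≼ (suc m) {h} {i} h< i< C≢0 = low , lucas-≼ m (high-< m h<) (high-< m i<) high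
    where
    p∤factor : ¬ p ∣ lucasFactor i h
    p∤factor p∣ = C≢0 (trans (lucas i h) (n∣m⇒m%n≡0 _ p p∣))
    low : h % p ≤ i % p
    low with h % p ≤? i % p
    ... | yes h≤i = h≤i
    ... | no  h≰i = ⊥-elim (p∤factor (subst (p ∣_) (sym factor≡0) (p ∣0)))
      where
      factor≡0 : lucasFactor i h ≡ 0
      factor≡0 = trans (cong (((i / p) C (h / p)) *_) (k>n⇒nCk≡0 (≰⇒> h≰i)))
                       (*-zeroʳ ((i / p) C (h / p)))
    high : ((i / p) C (h / p)) % p ≢ 0
    high e = p∤factor (∣m⇒∣m*n _ (m%n≡0⇒n∣m _ p e))

  ≼-lucas : ∀ m {h i} → h < p ^ m → i < p ^ m → h ≼[ m ] i → (i C h) % p ≢ 0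
  ≼-lucas zero    (s≤s z≤n) (s≤s z≤n) _ e = 1+n≢0 (trans (sym (m<n⇒m%n≡m 1<p)) e)
  ≼-lucas (suc m) {h} {i} h< i< (low , high) C≡0
    with euclidsLemma ((i / p) C (h / p)) ((i % p) C (h % p)) p-prime p∣factor
    where
    p∣factor : p ∣ lucasFactor i h
    p∣factor = m%n≡0⇒n∣m _ p (trans (sym (lucas i h)) C≡0)
  ... | inj₁ p∣high = ≼-lucas m (high-< m h<) (high-< m i<) high (n∣m⇒m%n≡0 _ p p∣high)
  ... | inj₂ p∣low  = p∤C low (m%n<n i p) p∣low

-- Residues and quotients of the multiples x·b modulo Q, where Q ∤ b.
module Residues (Q b : ℕ) {{_ : NonZero Q}} (Q∤b : ¬ Q ∣ b) where

  r⁺ : ℕ → ℕ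
  r⁺ x = x * b % Q

  r⁻ : ℕ → ℕ
  r⁻ x = (- (+ (x * b))) %ℕ Q

  r⁻b : ℕ
  r⁻b = (- (+ b)) %ℕ Q

  quot : ℕ → ℕ
  quot x = x * b / Q

  -- quot is monotone, so the truncated differences d_{a+j} ∸ d_a are genuine ones.
  quot-mono : ∀ {x y} → x ≤ y → quot x ≤ quot y
  quot-mono x≤y = /-monoˡ-≤ Q (*-monoˡ-≤ b x≤y)

  -- r(−xb) = r((Q − x)b), since (Q − x)b + xb is a multiple of Q.
  r⁻≡r⁺ : ∀ {x} → x ≤ Q → r⁻ x ≡ r⁺ (Q ∸ x)
  r⁻≡r⁺ {x} x≤Q = trans (-%ℕ≡ (x * b) Q) (sym (%-complement {Q = Q} multiple))
    where
    open ≡-Reasoning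
    multiple : ((Q ∸ x) * b + x * b) % Q ≡ 0
    multiple = begin
      ((Q ∸ x) * b + x * b) % Q ≡⟨ cong (_% Q) (*-distribʳ-+ b (Q ∸ x) x) ⟨
      ((Q ∸ x + x) * b) % Q     ≡⟨ cong (λ z → (z * b) % Q) (m∸n+n≡m x≤Q) ⟩
      (Q * b) % Q               ≡⟨ cong (_% Q) (*-comm Q b) ⟩
      (b * Q) % Q               ≡⟨ m*n%n≡0 b Q ⟩
      0                         ∎

  -- As Q ∤ b, the residues of b and −b are nonzero and sum to Q.
  r⁻b+r⁺1≡Q : r⁻b + r⁺ 1 ≡ Q
  r⁻b+r⁺1≡Q = begin
    r⁻b + r⁺ 1            ≡⟨ cong₂ _+_ (-%ℕ≡ b Q) (cong (_% Q) (*-identityˡ b)) ⟩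
    (Q ∸ t) % Q + t       ≡⟨ cong (_+ t) (m<n⇒m%n≡m (∸-monoʳ-< 0<t (<⇒≤ t<Q))) ⟩
    (Q ∸ t) + t           ≡⟨ m∸n+n≡m (<⇒≤ t<Q) ⟩
    Q                     ∎
    where
    open ≡-Reasoning
    t = b % Q
    t<Q : t < Q
    t<Q = m%n<n b Q
    0<t : 0 < t
    0<t = n≢0⇒n>0 (λ t≡0 → Q∤b (m%n≡0⇒n∣m b Q t≡0))

  recombine : ∀ x y → Q * (quot x + quot y) + (r⁺ x + r⁺ y) ≡ (x + y) * b
  recombine x y = begin
    Q * (quot x + quot y) + (r⁺ x + r⁺ y)
      ≡⟨ regroup Q (quot x) (quot y) (r⁺ x) (r⁺ y) ⟩
    (r⁺ x + quot x * Q) + (r⁺ y + quot y * Q)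
      ≡⟨ cong₂ _+_ (m≡m%n+[m/n]*n (x * b) Q) (m≡m%n+[m/n]*n (y * b) Q) ⟨
    x * b + y * b
      ≡⟨ *-distribʳ-+ b x y ⟨
    (x + y) * b
      ∎
    where
    open ≡-Reasoning
    regroup : ∀ Q α β u v → Q * (α + β) + (u + v) ≡ (u + α * Q) + (v + β * Q)
    regroup = solve-∀

  -- (a + j + 1) + 1 = (a + 1) + (j + 1), split into quotients and residues.
  exchange : ∀ a j → Q * (quot (suc (a + j)) + quot 1) + (r⁺ (suc (a + j)) + r⁺ 1)
                   ≡ Q * (quot (suc a) + quot (suc j)) + (r⁺ (suc a) + r⁺ (suc j))
  exchange a j = trans (recombine (suc (a + j)) 1)
                       (trans (cong (λ z → suc z * b) same-sum) (sym (recombine (suc a) (suc j))))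
    where
    same-sum : a + j + 1 ≡ a + suc j
    same-sum = trans (+-comm (a + j) 1) (sym (+-suc a j))

  increment⇒residue : ∀ a j → quot (suc j) ∸ quot 1 ≤ quot (suc (a + j)) ∸ quot (suc a)
                      → r⁺ (suc (a + j)) < r⁻b + r⁺ (suc a)
  increment⇒residue a j gap = +-cancelʳ-< (r⁺ 1) _ _ (begin-strict
    r⁺ (suc (a + j)) + r⁺ 1     ≤⟨ split-≤ Q (exchange a j) quotients ⟩
    r⁺ (suc a) + r⁺ (suc j)     <⟨ +-monoʳ-< (r⁺ (suc a)) (m%n<n _ Q) ⟩
    r⁺ (suc a) + Q              ≡⟨ cong (λ z → r⁺ (suc a) + z) r⁻b+r⁺1≡Q ⟨
    r⁺ (suc a) + (r⁻b + r⁺ 1)   ≡⟨ +-assoc (r⁺ (suc a)) r⁻b (r⁺ 1) ⟨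
    (r⁺ (suc a) + r⁻b) + r⁺ 1   ≡⟨ cong (_+ r⁺ 1) (+-comm (r⁺ (suc a)) r⁻b) ⟩
    (r⁻b + r⁺ (suc a)) + r⁺ 1   ∎)
    where
    open ≤-Reasoning
    quotients : quot (suc a) + quot (suc j) ≤ quot (suc (a + j)) + quot 1
    quotients =
      ∸≤∸⇒+≤+ (quot-mono {1} {suc j} (s≤s z≤n)) (quot-mono {suc a} (s≤s (m≤m+n a j))) gap

  residue⇒increment : ∀ a j
                      → r⁺ (suc (a + j)) < r⁻b + r⁺ (suc a) ⊎ r⁺ (suc (a + j)) < r⁻b + r⁺ (suc j)
                      → quot (suc j) ∸ quot 1 ≤ quot (suc (a + j)) ∸ quot (suc a)
  residue⇒increment a j small =
    +≤+⇒∸≤∸ {quot 1} {quot (suc j)} {quot (suc a)} {quot (suc (a + j))}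
            (split-≥ Q (exchange a j) (residues small))
    where
    open ≤-Reasoning
    below : ∀ {z} → r⁺ (suc (a + j)) < r⁻b + z → z ≤ r⁺ (suc a) + r⁺ (suc j)
            → r⁺ (suc (a + j)) + r⁺ 1 < Q + (r⁺ (suc a) + r⁺ (suc j))
    below {z} lt z≤ = begin-strict
      r⁺ (suc (a + j)) + r⁺ 1 <⟨ +-monoˡ-< (r⁺ 1) lt ⟩
      (r⁻b + z) + r⁺ 1        ≡⟨ +-assoc r⁻b z (r⁺ 1) ⟩
      r⁻b + (z + r⁺ 1)        ≡⟨ cong (λ u → r⁻b + u) (+-comm z (r⁺ 1)) ⟩
      r⁻b + (r⁺ 1 + z)        ≡⟨ +-assoc r⁻b (r⁺ 1) z ⟨
      (r⁻b + r⁺ 1) + z        ≡⟨ cong (_+ z) r⁻b+r⁺1≡Q ⟩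
      Q + z                   ≤⟨ +-monoʳ-≤ Q z≤ ⟩
      Q + (r⁺ (suc a) + r⁺ (suc j)) ∎
    residues : r⁺ (suc (a + j)) < r⁻b + r⁺ (suc a) ⊎ r⁺ (suc (a + j)) < r⁻b + r⁺ (suc j)
               → r⁺ (suc (a + j)) + r⁺ 1 < Q + (r⁺ (suc a) + r⁺ (suc j))
    residues (inj₁ lt) = below lt (m≤m+n _ _)
    residues (inj₂ lt) = below lt (m≤n+m _ _)

module Theorem (p n b : ℕ) {{p≢0 : NonZero p}} (p-prime : Prime p) (p∤b : ¬ p ∣ b) where
  open Digits p {{p≢0}}
  open Lucas p {{p≢0}} p-prime

  Q : ℕ
  Q = q p n

  instance
    Q≢0 : NonZero Q
    Q≢0 = q-nonZero p n

  Q∤b : ¬ Q ∣ b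
  Q∤b Q∣b = p∤b (∣-trans (m∣m*n (p ^ n)) Q∣b)

  open Residues Q b Q∤b

  c : ℕ
  c = Q ∸ 1

  <Q⇒≤c : ∀ {x} → x < Q → x ≤ c
  <Q⇒≤c = <⇒≤pred

  ≤c⇒<Q : ∀ {x} → x ≤ c → x < Q
  ≤c⇒<Q = m≤pred[n]⇒suc[m]≤n

  infix 4 _≼_
  _≼_ : ℕ → ℕ → Set
  x ≼ y = x ≼[ suc n ] y

  r⁻-complement : ∀ x y → x + y ≡ c → r⁻ x ≡ r⁺ (suc y)
  r⁻-complement x y x+y≡c = trans (r⁻≡r⁺ (<⇒≤ (≤c⇒<Q x≤c))) (cong r⁺ Q∸x≡1+y)
    where
    open ≡-Reasoning
    x≤c : x ≤ c
    x≤c = subst (x ≤_) x+y≡c (m≤m+n x y)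
    Q∸x≡1+y : Q ∸ x ≡ suc y
    Q∸x≡1+y = begin
      Q ∸ x           ≡⟨ cong (_∸ x) (suc-pred Q) ⟨
      suc c ∸ x       ≡⟨ cong (λ z → suc z ∸ x) x+y≡c ⟨
      suc (x + y) ∸ x ≡⟨ cong (_∸ x) (+-suc x y) ⟨
      x + suc y ∸ x   ≡⟨ m+n∸m≡n x (suc y) ⟩
      suc y           ∎

  increment : ℕ → ℕ → ℕ
  increment j a = d p n b (a + j) ∸ d p n b a

  Increments : ℕ → List ℕ
  Increments j = map (increment j) (filter (λ a → T? (preceqᵇ p n a (c ∸ j))) (upTo Q))

  increment∈ : ∀ {j a} → a < Q → a ≼ c ∸ j → increment j a ∈ Increments j
  increment∈ {j} a<Q a≼ =
    ∈-map⁺ (increment j)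
           (∈-filter⁺ (λ a → T? (preceqᵇ p n a (c ∸ j))) (∈-upTo⁺ a<Q) (≼⇒⪯ n a≼))

  ∈Increments : ∀ {j y} → y ∈ Increments j → ∃ λ a → a < Q × a ≼ c ∸ j × y ≡ increment j a
  ∈Increments {j} y∈ with ∈-map⁻ (increment j) y∈
  ... | a , a∈ , refl with ∈-filter⁻ (λ a → T? (preceqᵇ p n a (c ∸ j))) {xs = upTo Q} a∈
  ...   | a∈upTo , a⪯ = a , ∈-upTo⁻ a∈upTo , ⪯⇒≼ n a⪯ , refl

  MinimaAtZero : Set
  MinimaAtZero = ∀ j → j < q p n → w p n b j ≡ d p n b j ∸ d p n b 0

  ResidueCondition : Set
  ResidueCondition =
    ∀ h i j → h ≤ i → i ≤ j → j < q p n → i + j ≡ (q p n ∸ 1) + h → ((i C h) % p ≢ 0) →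
      r p n (- (+ (h * b))) < r p n (- (+ b)) + r p n (- (+ (i * b)))

  -- Given (h, i, j), the pair (a, j₀) = (c − i, i − h) is admissible, because
  -- h ≼ i by Lucas; the bound w_{j₀} ≤ d_{a+j₀} − d_a is the residue inequality.
  necessity : MinimaAtZero → ResidueCondition
  necessity minima h i j h≤i i≤j j<Q _ C≢0 =
    subst₂ (λ u v → u < r⁻b + v)
           (sym (r⁻-complement h (a + j₀) h+[a+j₀]≡c)) (sym (r⁻-complement i a i+a≡c))
      (increment⇒residue a j₀ gap)
    where
    i<Q = ≤-<-trans i≤j j<Q
    h<Q = ≤-<-trans h≤i i<Q
    j₀ = i ∸ h
    a = c ∸ i
    h+j₀≡i : h + j₀ ≡ i
    h+j₀≡i = m+[n∸m]≡n h≤i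
    i+a≡c : i + a ≡ c
    i+a≡c = m+[n∸m]≡n (<Q⇒≤c i<Q)
    h+[a+j₀]≡c : h + (a + j₀) ≡ c
    h+[a+j₀]≡c = begin
      h + (a + j₀) ≡⟨ cong (λ z → h + z) (+-comm a j₀) ⟩
      h + (j₀ + a) ≡⟨ +-assoc h j₀ a ⟨
      h + j₀ + a   ≡⟨ cong (_+ a) h+j₀≡i ⟩
      i + a        ≡⟨ i+a≡c ⟩
      c            ∎
      where open ≡-Reasoning
    j₀<Q : j₀ < Q
    j₀<Q = ≤-<-trans (m∸n≤m i h) i<Q
    a≼ : a ≼ c ∸ j₀
    a≼ = ≼-complement (suc n) (m+[n∸m]≡n (<Q⇒≤c j₀<Q)) i+a≡c
           (≼-sub (suc n) h<Q h+j₀≡i (lucas-≼ (suc n) h<Q i<Q C≢0))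
    gap : d p n b j₀ ∸ d p n b 0 ≤ increment j₀ a
    gap = subst (_≤ increment j₀ a) (minima j₀ j₀<Q)
                (minList-≤ (increment∈ (≤c⇒<Q (m∸n≤m c i)) a≼))

  -- For admissible a, set J = c − j, A = c − a and K = J − a. Then K ≼ A and
  -- K ≼ J, so the residue condition applies to (K, min(A, J), max(A, J)).
  increment-bound : ResidueCondition → ∀ {a j} → a < Q → j < Q → a ≼ c ∸ j
                    → d p n b j ∸ d p n b 0 ≤ increment j a
  increment-bound condition {a} {j} a<Q j<Q a≼J = residue⇒increment a j small
    where
    open ≡-Reasoning
    J = c ∸ j
    A = c ∸ a
    K = J ∸ a
    J+j≡c : J + j ≡ c
    J+j≡c = trans (+-comm J j) (m+[n∸m]≡n (<Q⇒≤c j<Q))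
    a+A≡c : a + A ≡ c
    a+A≡c = m+[n∸m]≡n (<Q⇒≤c a<Q)
    a+K≡J : a + K ≡ J
    a+K≡J = m+[n∸m]≡n (≼⇒≤ (suc n) a<Q a≼J)
    K+[a+j]≡c : K + (a + j) ≡ c
    K+[a+j]≡c = begin
      K + (a + j) ≡⟨ +-assoc K a j ⟨
      K + a + j   ≡⟨ cong (_+ j) (+-comm K a) ⟩
      a + K + j   ≡⟨ cong (_+ j) a+K≡J ⟩
      J + j       ≡⟨ J+j≡c ⟩
      c           ∎
    j+K≡A : j + K ≡ A
    j+K≡A = +-cancelˡ-≡ a (j + K) A (begin
      a + (j + K) ≡⟨ cong (λ z → a + z) (+-comm j K) ⟩
      a + (K + j) ≡⟨ +-assoc a K j ⟨
      a + K + j   ≡⟨ cong (_+ j) a+K≡J ⟩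
      J + j       ≡⟨ J+j≡c ⟩
      c           ≡⟨ a+A≡c ⟨
      a + A       ∎)
    A+J≡c+K : A + J ≡ c + K
    A+J≡c+K = begin
      A + J       ≡⟨ cong (_+ J) j+K≡A ⟨
      j + K + J   ≡⟨ +-assoc j K J ⟩
      j + (K + J) ≡⟨ cong (λ z → j + z) (+-comm K J) ⟩
      j + (J + K) ≡⟨ +-assoc j J K ⟨
      j + J + K   ≡⟨ cong (_+ K) (trans (+-comm j J) J+j≡c) ⟩
      c + K       ∎
    K<Q : K < Q
    K<Q = ≤c⇒<Q (≤-trans (m∸n≤m J a) (m∸n≤m c j))
    K≼J : K ≼ J
    K≼J = ≼-sub (suc n) a<Q a+K≡J a≼J
    K≼A : K ≼ A
    K≼A = ≼-sub (suc n) j<Q j+K≡A (≼-complement (suc n) a+A≡c J+j≡c a≼J)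
    -- the residue condition at (K, i, i′), read through complementary indices
    apply : ∀ {i i′ x} → i + x ≡ c → K ≼ i → i ≤ i′ → i′ < Q → i + i′ ≡ c + K
            → r⁺ (suc (a + j)) < r⁻b + r⁺ (suc x)
    apply {i} {i′} {x} i+x≡c K≼i i≤i′ i′<Q sum =
      subst₂ (λ u v → u < r⁻b + v) (r⁻-complement K (a + j) K+[a+j]≡c) (r⁻-complement i x i+x≡c)
        (condition K _ _ (≼⇒≤ (suc n) K<Q K≼i) i≤i′ i′<Q sum
                   (≼-lucas (suc n) K<Q (≤-<-trans i≤i′ i′<Q) K≼i))
    small : r⁺ (suc (a + j)) < r⁻b + r⁺ (suc a) ⊎ r⁺ (suc (a + j)) < r⁻b + r⁺ (suc j)
    small with A ≤? J
    ... | yes A≤J = inj₁ (apply (trans (+-comm A a) a+A≡c) K≼A A≤J (≤c⇒<Q (m∸n≤m c j))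
                                A+J≡c+K)
    ... | no  A≰J = inj₂ (apply J+j≡c K≼J (<⇒≤ (≰⇒> A≰J)) (≤c⇒<Q (m∸n≤m c a))
                                (trans (+-comm J A) A+J≡c+K))

  sufficiency : ResidueCondition → MinimaAtZero
  sufficiency condition j j<Q = minList-unique (increment∈ (>-nonZero⁻¹ Q) (0≼ (suc n) (c ∸ j))) least
    where
    least : ∀ {y} → y ∈ Increments j → d p n b j ∸ d p n b 0 ≤ y
    least y∈ with ∈Increments y∈
    ... | a , a<Q , a≼ , refl = increment-bound condition a<Q j<Q a≼

lemma2p4 : (p n bmax : ℕ) → {{_ : NonZero p}} → Prime p → 1 ≤ bmax → ¬ (p ∣ bmax) →
    ((∀ j → j < q p n → w p n bmax j ≡ d p n bmax j ∸ d p n bmax 0)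
      ⇔ (∀ h i j → h ≤ i → i ≤ j → j < q p n → i + j ≡ (q p n ∸ 1) + h → ((i C h) % p ≢ 0) →
           r p n (- (+ (h * bmax))) < r p n (- (+ bmax)) + r p n (- (+ (i * bmax)))))
lemma2p4 p n bmax p-prime _ p∤bmax = mk⇔ necessity sufficiency
  where open Theorem p n bmax p-prime p∤bmax
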